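{- Let $k,m$ be positive integers and let $\Gamma=H\oplus K$ where $H,K$ are Abelian groups with $|H|=k^2m^2$ and $|K|=k^2$. If there exists an $H$-magic square $\mathrm{MS}_{H}(km)$, then there exists a $\Gamma$-magic square $\mathrm{MS}_{\Gamma}(k^2m)$.
   Context: For an Abelian group $(\Gamma,+)$ of order $n^2$, a $\Gamma$-magic square $\mathrm{MS}_{\Gamma}(n)$ (of side $n$) is an $n\times n$ array whose entries are all the elements of $\Gamma$ (each element appearing exactly once) such that all row sums, all column sums, the sum along the main diagonal and the sum along the backward main diagonal are equal to the same element $\mu\in\Gamma$. -}

module Defs where

open import Level using (Level; _⊔_)
open import Data.Nat.Base using (ℕ)
open import Data.Fin.Base using (Fin; opposite)
open import Data.Product.Base using (Σ; ∃; ∃₂; _×_; _,_)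
open import Relation.Binary.PropositionalEquality.Core using (_≡_)
open import Algebra.Bundles using (AbelianGroup)
import Algebra.Construct.DirectProduct as DP
import Algebra.Definitions.RawMonoid as RM

_⊕_ : ∀ {a b ℓ₁ ℓ₂} → AbelianGroup a ℓ₁ → AbelianGroup b ℓ₂ →
      AbelianGroup (a ⊔ b) (ℓ₁ ⊔ ℓ₂)
H ⊕ K = DP.abelianGroup H K

module _ {c ℓ} (G : AbelianGroup c ℓ) where
  open AbelianGroup G

  ∑ : ∀ {n} → (Fin n → Carrier) → Carrier
  ∑ = RM.sum rawMonoid

  HasOrder : ℕ → Set (c ⊔ ℓ)
  HasOrder N = Σ (Fin N → Carrier) λ e →
      (∀ i j → e i ≈ e j → i ≡ j)
    × (∀ g → ∃ λ i → e i ≈ g)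

  IsArrangement : ∀ n → (Fin n → Fin n → Carrier) → Set (c ⊔ ℓ)
  IsArrangement n sq =
      (∀ i j i′ j′ → sq i j ≈ sq i′ j′ → (i ≡ i′ × j ≡ j′))
    × (∀ g → ∃₂ λ i j → sq i j ≈ g)

  IsMagic : ∀ n → (Fin n → Fin n → Carrier) → Carrier → Set ℓ
  IsMagic n sq μ =
      (∀ i → ∑ (λ j → sq i j) ≈ μ)
    × (∀ j → ∑ (λ i → sq i j) ≈ μ)
    × ∑ (λ i → sq i i) ≈ μ
    × ∑ (λ i → sq i (opposite i)) ≈ μ

  MagicSquare : ℕ → Set (c ⊔ ℓ)
  MagicSquare n = Σ (Fin n → Fin n → Carrier) λ sq →
    IsArrangement n sq × ∃ λ μ → IsMagic n sq μ

-- Index rows and columns by pairs (p , i) with p ∈ ℤ/k and i an index of the given H-magic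
-- square A, and let ⌊i⌋ ∈ ℤ/k be the block of m consecutive indices containing i. Put
--   ((p , i) , (q , j))  ↦  (A i j , κ (p + ⌊j⌋ , q + ⌊i⌋ + ⌊j⌋))
-- with κ : ℤ/k × ℤ/k → K a bijection. The H-component tiles A, so every line sums to k · μ.
-- For fixed (i , j) the K-component is a bijection in (p , q), so every element of H ⊕ K
-- occurs exactly once. Along every row, column and both diagonals the argument of κ runs
-- through ℤ/k × ℤ/k exactly m times (only translations of ℤ/k are involved, and on the
-- antidiagonal a + opposite a is constant), so all K-components of line sums agree.
module Submission where

open import Defs
open import Level using (Level)
open import Data.Nat.Base using (ℕ; zero; suc; _+_; _*_; _∸_; NonZero)
import Data.Nat.Properties as ℕ
open import Data.Nat.DivMod using (_%_; _mod_; %-distribˡ-+; [m+n]%n≡m%n; m<n⇒m%n≡m)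
open import Data.Nat.Tactic.RingSolver using (solve-∀)
open import Data.Fin.Base
  using (Fin; zero; suc; toℕ; opposite; combine; remQuot; quotient; remainder; _↑ˡ_; _↑ʳ_)
open import Data.Fin.Properties
  using ( toℕ-injective; toℕ<n; toℕ-fromℕ<; opposite-prop; opposite-involutive
        ; toℕ-combine; combine-injective; remQuot-combine; combine-remQuot)
open import Data.Fin.Permutation using (Permutation; permutation)
open import Data.Product.Base using (Σ; _×_; _,_; ∃; ∃₂; proj₁; proj₂; map; uncurry)
open import Data.Product.Properties using (,-injectiveˡ; ,-injectiveʳ)
open import Function.Base using (_∘_)
open import Relation.Binary.PropositionalEquality as ≡ using (_≡_; cong; cong₂; subst; module ≡-Reasoning)
open import Algebra.Bundles using (AbelianGroup; CommutativeMonoid)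
import Algebra.Properties.CommutativeMonoid.Sum as CommutativeMonoidSum
import Algebra.Definitions.RawMonoid as RawMonoidDefinitions

suc[i+opposite-i]≡n : ∀ {n} (i : Fin n) → suc (toℕ i + toℕ (opposite i)) ≡ n
suc[i+opposite-i]≡n {n} i = begin
  suc (toℕ i + toℕ (opposite i))   ≡⟨ cong (λ t → suc (toℕ i + t)) (opposite-prop i) ⟩
  suc (toℕ i) + (n ∸ suc (toℕ i))  ≡⟨ ℕ.m+[n∸m]≡n (toℕ<n i) ⟩
  n                                ∎
  where open ≡-Reasoning

opposite-unique : ∀ {n} (i j : Fin n) → suc (toℕ i + toℕ j) ≡ n → opposite i ≡ j
opposite-unique i j eq = toℕ-injective (ℕ.+-cancelˡ-≡ (toℕ i) _ _
  (ℕ.suc-injective (≡.trans (suc[i+opposite-i]≡n i) (≡.sym eq))))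

opposite-combine : ∀ {n k} (p : Fin n) (i : Fin k) →
                   opposite (combine p i) ≡ combine (opposite p) (opposite i)
opposite-combine {n} {k} p i = opposite-unique _ _ (begin
  suc (toℕ (combine p i) + toℕ (combine p′ i′))  ≡⟨ cong₂ (λ s t → suc (s + t)) (toℕ-combine p i) (toℕ-combine p′ i′) ⟩
  suc (k * P + I + (k * P′ + I′))                ≡⟨ regroup k P I P′ I′ ⟩
  k * (P + P′) + suc (I + I′)                    ≡⟨ cong (k * (P + P′) +_) (suc[i+opposite-i]≡n i) ⟩
  k * (P + P′) + k                               ≡⟨ factor k (P + P′) ⟩
  suc (P + P′) * k                               ≡⟨ cong (_* k) (suc[i+opposite-i]≡n p) ⟩
  n * k                                          ∎)
  where
  open ≡-Reasoning
  p′ = opposite p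
  i′ = opposite i
  P = toℕ p
  P′ = toℕ p′
  I = toℕ i
  I′ = toℕ i′
  regroup : ∀ k P I P′ I′ → suc (k * P + I + (k * P′ + I′)) ≡ k * (P + P′) + suc (I + I′)
  regroup = solve-∀
  factor : ∀ k s → k * s + k ≡ suc s * k
  factor = solve-∀

remQuot-opposite : ∀ {n} k (i : Fin (n * k)) →
                   remQuot k (opposite i) ≡ map opposite opposite (remQuot {n} k i)
remQuot-opposite {n} k i = begin
  remQuot k (opposite i)                         ≡⟨ cong (remQuot k ∘ opposite) (combine-remQuot {n} k i) ⟨
  remQuot k (opposite (combine q r))             ≡⟨ cong (remQuot k) (opposite-combine q r) ⟩
  remQuot k (combine (opposite q) (opposite r))  ≡⟨ remQuot-combine (opposite q) (opposite r) ⟩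
  (opposite q , opposite r)                      ∎
  where
  open ≡-Reasoning
  q = quotient k i
  r = remainder {n} k i

remQuot-injective : ∀ {n} k (i j : Fin (n * k)) → remQuot {n} k i ≡ remQuot k j → i ≡ j
remQuot-injective {n} k i j eq =
  ≡.trans (≡.sym (combine-remQuot {n} k i)) (≡.trans (cong (uncurry combine) eq) (combine-remQuot {n} k j))

opposite-permutation : ∀ {n} → Permutation n n
opposite-permutation = permutation opposite opposite opposite-involutive opposite-involutive

module _ {k : ℕ} .{{_ : NonZero k}} where

  infixl 6 _⊞_

  _⊞_ : Fin k → Fin k → Fin k
  x ⊞ y = (toℕ x + toℕ y) mod k

  ⊟_ : Fin k → Fin k
  ⊟ x = (k ∸ toℕ x) mod k

  toℕ-⊞ : ∀ x y → toℕ (x ⊞ y) ≡ (toℕ x + toℕ y) % k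
  toℕ-⊞ x y = toℕ-fromℕ< _

  ⊞-comm : ∀ x y → x ⊞ y ≡ y ⊞ x
  ⊞-comm x y = cong (_mod k) (ℕ.+-comm (toℕ x) (toℕ y))

  ⊞-assoc : ∀ x y z → x ⊞ y ⊞ z ≡ x ⊞ (y ⊞ z)
  ⊞-assoc x y z = toℕ-injective (begin
    toℕ (x ⊞ y ⊞ z)                ≡⟨ toℕ-⊞ (x ⊞ y) z ⟩
    (toℕ (x ⊞ y) + Z) % k          ≡⟨ cong₂ (λ s t → (s + t) % k) (toℕ-⊞ x y) (≡.sym (m<n⇒m%n≡m (toℕ<n z))) ⟩
    ((X + Y) % k + Z % k) % k      ≡⟨ %-distribˡ-+ (X + Y) Z k ⟨
    (X + Y + Z) % k                ≡⟨ cong (_% k) (ℕ.+-assoc X Y Z) ⟩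
    (X + (Y + Z)) % k              ≡⟨ %-distribˡ-+ X (Y + Z) k ⟩
    (X % k + (Y + Z) % k) % k      ≡⟨ cong₂ (λ s t → (s + t) % k) (m<n⇒m%n≡m (toℕ<n x)) (≡.sym (toℕ-⊞ y z)) ⟩
    (X + toℕ (y ⊞ z)) % k          ≡⟨ toℕ-⊞ x (y ⊞ z) ⟨
    toℕ (x ⊞ (y ⊞ z))              ∎)
    where
    open ≡-Reasoning
    X = toℕ x
    Y = toℕ y
    Z = toℕ z

  ⊞-⊟-cancelʳ : ∀ x c → x ⊞ c ⊞ ⊟ c ≡ x
  ⊞-⊟-cancelʳ x c = toℕ-injective (begin
    toℕ (x ⊞ c ⊞ ⊟ c)                  ≡⟨ toℕ-⊞ (x ⊞ c) (⊟ c) ⟩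
    (toℕ (x ⊞ c) + toℕ (⊟ c)) % k      ≡⟨ cong₂ (λ s t → (s + t) % k) (toℕ-⊞ x c) (toℕ-fromℕ< _) ⟩
    ((X + C) % k + (k ∸ C) % k) % k    ≡⟨ %-distribˡ-+ (X + C) (k ∸ C) k ⟨
    (X + C + (k ∸ C)) % k              ≡⟨ cong (_% k) (ℕ.+-assoc X C (k ∸ C)) ⟩
    (X + (C + (k ∸ C))) % k            ≡⟨ cong (λ t → (X + t) % k) (ℕ.m+[n∸m]≡n (ℕ.<⇒≤ (toℕ<n c))) ⟩
    (X + k) % k                        ≡⟨ [m+n]%n≡m%n X k ⟩
    X % k                              ≡⟨ m<n⇒m%n≡m (toℕ<n x) ⟩
    X                                  ∎)
    where
    open ≡-Reasoning
    X = toℕ x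
    C = toℕ c

  ⊟-⊞-cancelʳ : ∀ x c → x ⊞ ⊟ c ⊞ c ≡ x
  ⊟-⊞-cancelʳ x c = begin
    x ⊞ ⊟ c ⊞ c    ≡⟨ ⊞-assoc x (⊟ c) c ⟩
    x ⊞ (⊟ c ⊞ c)  ≡⟨ cong (x ⊞_) (⊞-comm (⊟ c) c) ⟩
    x ⊞ (c ⊞ ⊟ c)  ≡⟨ ⊞-assoc x c (⊟ c) ⟨
    x ⊞ c ⊞ ⊟ c    ≡⟨ ⊞-⊟-cancelʳ x c ⟩
    x              ∎
    where open ≡-Reasoning

  ⊞-cancelʳ : ∀ {x y} c → x ⊞ c ≡ y ⊞ c → x ≡ y
  ⊞-cancelʳ {x} {y} c eq = begin
    x            ≡⟨ ⊞-⊟-cancelʳ x c ⟨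
    x ⊞ c ⊞ ⊟ c  ≡⟨ cong (_⊞ ⊟ c) eq ⟩
    y ⊞ c ⊞ ⊟ c  ≡⟨ ⊞-⊟-cancelʳ y c ⟩
    y            ∎
    where open ≡-Reasoning

  ⊞-opposite : ∀ x → x ⊞ opposite x ≡ (k ∸ 1) mod k
  ⊞-opposite x = cong (λ n → (n ∸ 1) mod k) (suc[i+opposite-i]≡n x)

  ⊞-permutation : Fin k → Permutation k k
  ⊞-permutation c = permutation (_⊞ c) (_⊞ ⊟ c) (λ x → ⊟-⊞-cancelʳ x c) (λ x → ⊞-⊟-cancelʳ x c)

  shear : Fin k → Fin k → Fin k → Fin k → Fin k × Fin k
  shear p a q c = p ⊞ c , q ⊞ a ⊞ c

  shear-injective : ∀ {p p′ q q′} a c → shear p a q c ≡ shear p′ a q′ c → p ≡ p′ × q ≡ q′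
  shear-injective a c eq =
    ⊞-cancelʳ c (,-injectiveˡ eq) , ⊞-cancelʳ a (⊞-cancelʳ c (,-injectiveʳ eq))

  shear-surjective : ∀ a c xy → ∃₂ λ p q → shear p a q c ≡ xy
  shear-surjective a c (x , y) = x ⊞ ⊟ c , y ⊞ ⊟ c ⊞ ⊟ a ,
    cong₂ _,_ (⊟-⊞-cancelʳ x c) (≡.trans (cong (_⊞ c) (⊟-⊞-cancelʳ (y ⊞ ⊟ c) a)) (⊟-⊞-cancelʳ y c))

module Summation {c ℓ} (M : CommutativeMonoid c ℓ) where

  open CommutativeMonoid M
  open CommutativeMonoidSum M
    using (sum; sum-syntax; sum-cong-≋; sum-cong-≗; sum-replicate; ∑-comm; ∑-permute)
  open RawMonoidDefinitions rawMonoid using () renaming (_×_ to _×ᵐ_)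
  open import Relation.Binary.Reasoning.Setoid setoid

  ∑-splitAt : ∀ a b (f : Fin (a + b) → Carrier) →
              sum f ≈ ∑[ i < a ] f (i ↑ˡ b) ∙ ∑[ j < b ] f (a ↑ʳ j)
  ∑-splitAt zero    b f = sym (identityˡ _)
  ∑-splitAt (suc a) b f = trans (∙-congˡ (∑-splitAt a b (f ∘ suc))) (sym (assoc _ _ _))

  ∑-combine : ∀ n k (f : Fin (n * k) → Carrier) →
              sum f ≈ ∑[ p < n ] ∑[ i < k ] f (combine p i)
  ∑-combine zero    k f = refl
  ∑-combine (suc n) k f = trans (∑-splitAt k (n * k) f) (∙-congˡ (∑-combine n k (f ∘ (k ↑ʳ_))))

  ∑-remQuot : ∀ n k (g : Fin n → Fin k → Carrier) →
              ∑[ r < n * k ] g (quotient k r) (remainder {n} k r) ≈ ∑[ p < n ] ∑[ i < k ] g p i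
  ∑-remQuot n k g = trans (∑-combine n k _) (sum-cong-≋ λ p → reflexive (sum-cong-≗ λ i →
    cong (uncurry g) (remQuot-combine p i)))

  ∑-quotient : ∀ n k (f : Fin n → Carrier) →
               ∑[ r < n * k ] f (quotient k r) ≈ ∑[ p < n ] (k ×ᵐ f p)
  ∑-quotient n k f = trans (∑-remQuot n k (λ p _ → f p)) (sum-cong-≋ λ p → sum-replicate k {f p})

  ∑-opposite : ∀ {n} (f : Fin n → Carrier) → ∑[ i < n ] f (opposite i) ≈ sum f
  ∑-opposite f = sym (∑-permute f opposite-permutation)

  module _ {k : ℕ} .{{_ : NonZero k}} where

    ∑-⊞ʳ : ∀ c (f : Fin k → Carrier) → ∑[ x < k ] f (x ⊞ c) ≈ sum f
    ∑-⊞ʳ c f = sym (∑-permute f (⊞-permutation c))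

    ∑-⊞ˡ : ∀ c (f : Fin k → Carrier) → ∑[ x < k ] f (c ⊞ x) ≈ sum f
    ∑-⊞ˡ c f = trans (reflexive (sum-cong-≗ λ x → cong f (⊞-comm c x))) (∑-⊞ʳ c f)

    ∑² : (Fin k × Fin k → Carrier) → Carrier
    ∑² G = ∑[ x < k ] ∑[ y < k ] G (x , y)

    shear-row-sum : ∀ p a G → ∑[ q < k ] ∑[ c < k ] G (shear p a q c) ≈ ∑² G
    shear-row-sum p a G = begin
      ∑[ q < k ] ∑[ c < k ] G (p ⊞ c , q ⊞ a ⊞ c)  ≈⟨ ∑-comm (λ q c → G (p ⊞ c , q ⊞ a ⊞ c)) ⟩
      ∑[ c < k ] ∑[ q < k ] G (p ⊞ c , q ⊞ a ⊞ c)  ≈⟨ sum-cong-≋ (λ c → trans (∑-⊞ʳ a (λ z → G (p ⊞ c , z ⊞ c)))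
                                                                             (∑-⊞ʳ c (λ y → G (p ⊞ c , y)))) ⟩
      ∑[ c < k ] ∑[ y < k ] G (p ⊞ c , y)          ≈⟨ ∑-⊞ˡ p (λ x → ∑[ y < k ] G (x , y)) ⟩
      ∑² G                                          ∎

    shear-column-sum : ∀ q c G → ∑[ p < k ] ∑[ a < k ] G (shear p a q c) ≈ ∑² G
    shear-column-sum q c G = begin
      ∑[ p < k ] ∑[ a < k ] G (p ⊞ c , q ⊞ a ⊞ c)  ≈⟨ sum-cong-≋ (λ p → trans (∑-⊞ˡ q (λ z → G (p ⊞ c , z ⊞ c)))
                                                                             (∑-⊞ʳ c (λ y → G (p ⊞ c , y)))) ⟩
      ∑[ p < k ] ∑[ y < k ] G (p ⊞ c , y)          ≈⟨ ∑-⊞ʳ c (λ x → ∑[ y < k ] G (x , y)) ⟩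
      ∑² G                                          ∎

    shear-diagonal-sum : ∀ G → ∑[ p < k ] ∑[ a < k ] G (shear p a p a) ≈ ∑² G
    shear-diagonal-sum G = begin
      ∑[ p < k ] ∑[ a < k ] G (p ⊞ a , p ⊞ a ⊞ a)  ≈⟨ ∑-comm (λ p a → G (p ⊞ a , p ⊞ a ⊞ a)) ⟩
      ∑[ a < k ] ∑[ p < k ] G (p ⊞ a , p ⊞ a ⊞ a)  ≈⟨ sum-cong-≋ (λ a → ∑-⊞ʳ a (λ x → G (x , x ⊞ a))) ⟩
      ∑[ a < k ] ∑[ x < k ] G (x , x ⊞ a)          ≈⟨ ∑-comm (λ a x → G (x , x ⊞ a)) ⟩
      ∑[ x < k ] ∑[ a < k ] G (x , x ⊞ a)          ≈⟨ sum-cong-≋ (λ x → ∑-⊞ˡ x (λ y → G (x , y))) ⟩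
      ∑² G                                          ∎

    -- a ⊞ opposite a does not depend on a, which decouples the two coordinates.
    shear-antidiagonal-sum : ∀ G → ∑[ p < k ] ∑[ a < k ] G (shear p a (opposite p) (opposite a)) ≈ ∑² G
    shear-antidiagonal-sum G = begin
      ∑[ p < k ] ∑[ a < k ] G (p ⊞ opposite a , opposite p ⊞ a ⊞ opposite a)
        ≈⟨ reflexive (sum-cong-≗ λ p → sum-cong-≗ λ a → cong (λ y → G (p ⊞ opposite a , y)) (constant p a)) ⟩
      ∑[ p < k ] ∑[ a < k ] G (p ⊞ opposite a , opposite p ⊞ ω)
        ≈⟨ sum-cong-≋ (λ p → trans (∑-opposite (λ a → G (p ⊞ a , opposite p ⊞ ω)))
                                   (∑-⊞ˡ p (λ x → G (x , opposite p ⊞ ω)))) ⟩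
      ∑[ p < k ] ∑[ x < k ] G (x , opposite p ⊞ ω)
        ≈⟨ ∑-comm (λ p x → G (x , opposite p ⊞ ω)) ⟩
      ∑[ x < k ] ∑[ p < k ] G (x , opposite p ⊞ ω)
        ≈⟨ sum-cong-≋ (λ x → trans (∑-opposite (λ p → G (x , p ⊞ ω))) (∑-⊞ʳ ω (λ y → G (x , y)))) ⟩
      ∑² G
        ∎
      where
      ω : Fin k
      ω = (k ∸ 1) mod k
      constant : ∀ p a → opposite p ⊞ a ⊞ opposite a ≡ opposite p ⊞ ω
      constant p a = ≡.trans (⊞-assoc (opposite p) a (opposite a)) (cong (opposite p ⊞_) (⊞-opposite a))

flatten : ∀ {a} {A : Set a} {k n} → (Fin k × Fin n → Fin k × Fin n → A) → Fin (k * n) → Fin (k * n) → A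
flatten {k = k} {n} F r s = F (remQuot {k} n r) (remQuot {k} n s)

tile : ∀ {a} {A : Set a} {k n} → (Fin n → Fin n → A) → Fin k × Fin n → Fin k × Fin n → A
tile A (_ , i) (_ , j) = A i j

latin : ∀ {k} .{{_ : NonZero k}} m → Fin k × Fin (k * m) → Fin k × Fin (k * m) → Fin k × Fin k
latin m (p , i) (q , j) = shear p (quotient m i) q (quotient m j)

product : ∀ {a b} {X : Set a} {Y : Set b} {k} .{{_ : NonZero k}} m →
          (Fin (k * m) → Fin (k * m) → X) → (Fin k × Fin k → Y) →
          Fin k × Fin (k * m) → Fin k × Fin (k * m) → X × Y
product m A κ u v = tile A u v , κ (latin m u v)

module _ {c ℓ} (G : AbelianGroup c ℓ) where

  open AbelianGroup G
  open Summation commutativeMonoid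
  open CommutativeMonoidSum commutativeMonoid using (sum-syntax; sum-cong-≋; sum-cong-≗; sum-replicate)
  open RawMonoidDefinitions rawMonoid using () renaming (_×_ to _×ᵐ_)

  hasOrder-* : ∀ {k n} → HasOrder G (k * n) →
               Σ (Fin k × Fin n → Carrier) λ e → (∀ x y → e x ≈ e y → x ≡ y) × (∀ g → ∃ λ x → e x ≈ g)
  hasOrder-* {k} {n} (e , injective , surjective) =
      e ∘ uncurry combine
    , (λ x y eq → uncurry (cong₂ _,_) (combine-injective _ _ _ _ (injective _ _ eq)))
    , λ g → let (r , er) = surjective g in remQuot n r , trans (reflexive (cong e (combine-remQuot {k} n r))) er

  isArrangement-flatten : ∀ {k n} (F : Fin k × Fin n → Fin k × Fin n → Carrier) →
    (∀ u v u′ v′ → F u v ≈ F u′ v′ → u ≡ u′ × v ≡ v′) →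
    (∀ g → ∃₂ λ u v → F u v ≈ g) →
    IsArrangement G (k * n) (flatten F)
  isArrangement-flatten {k} {n} F injective surjective =
      (λ r s r′ s′ eq → map (remQuot-injective n r r′) (remQuot-injective n s s′) (injective _ _ _ _ eq))
    , λ g → let (u , v , eq) = surjective g in
        uncurry combine u , uncurry combine v ,
        trans (reflexive (cong₂ F (remQuot-combine (proj₁ u) (proj₂ u)) (remQuot-combine (proj₁ v) (proj₂ v)))) eq

  isMagic-flatten : ∀ {k n} (F : Fin k × Fin n → Fin k × Fin n → Carrier) μ →
    (∀ u → ∑[ q < k ] ∑[ j < n ] F u (q , j) ≈ μ) →
    (∀ v → ∑[ p < k ] ∑[ i < n ] F (p , i) v ≈ μ) →
    ∑[ p < k ] ∑[ i < n ] F (p , i) (p , i) ≈ μ →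
    ∑[ p < k ] ∑[ i < n ] F (p , i) (opposite p , opposite i) ≈ μ →
    IsMagic G (k * n) (flatten F) μ
  isMagic-flatten {k} {n} F μ row col diag anti =
      (λ r → trans (∑-remQuot k n λ q j → F (remQuot n r) (q , j)) (row (remQuot n r)))
    , (λ s → trans (∑-remQuot k n λ p i → F (p , i) (remQuot n s)) (col (remQuot n s)))
    , trans (∑-remQuot k n λ p i → F (p , i) (p , i)) diag
    , trans (reflexive (sum-cong-≗ λ r → cong (F (remQuot n r)) (remQuot-opposite n r)))
            (trans (∑-remQuot k n λ p i → F (p , i) (opposite p , opposite i)) anti)

  ∑-≈-replicate : ∀ k {f : Fin k → Carrier} {x} → (∀ p → f p ≈ x) → ∑[ p < k ] f p ≈ k ×ᵐ x
  ∑-≈-replicate k eq = trans (sum-cong-≋ eq) (sum-replicate k)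

  isMagic-tile : ∀ k {n} {A : Fin n → Fin n → Carrier} {μ} →
                 IsMagic G n A μ → IsMagic G (k * n) (flatten (tile {k = k} A)) (k ×ᵐ μ)
  isMagic-tile k {A = A} {μ} (row , col , diag , anti) = isMagic-flatten (tile {k = k} A) (k ×ᵐ μ)
    (λ u → ∑-≈-replicate k λ _ → row (proj₂ u))
    (λ v → ∑-≈-replicate k λ _ → col (proj₂ v))
    (∑-≈-replicate k λ _ → diag)
    (∑-≈-replicate k λ _ → anti)

  isMagic-latin : ∀ {k} .{{_ : NonZero k}} m (κ : Fin k × Fin k → Carrier) →
    IsMagic G (k * (k * m)) (flatten (λ u v → κ (latin m u v))) (∑² (λ xy → m ×ᵐ κ xy))
  isMagic-latin {k} m κ = isMagic-flatten (λ u v → κ (latin m u v)) _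
    (λ u → trans (∑-inflate λ q c → κ (shear (proj₁ u) (quotient m (proj₂ u)) q c)) (shear-row-sum _ _ _))
    (λ v → trans (∑-inflate λ p a → κ (shear p a (proj₁ v) (quotient m (proj₂ v)))) (shear-column-sum _ _ _))
    (trans (∑-inflate λ p a → κ (shear p a p a)) (shear-diagonal-sum _))
    (trans (reflexive (sum-cong-≗ λ p → sum-cong-≗ λ i →
             cong (κ ∘ shear p (quotient m i) (opposite p)) (cong proj₁ (remQuot-opposite m i))))
      (trans (∑-inflate λ p a → κ (shear p a (opposite p) (opposite a))) (shear-antidiagonal-sum _)))
    where
    ∑-inflate : ∀ (f : Fin k → Fin k → Carrier) →
                ∑[ p < k ] ∑[ i < k * m ] f p (quotient m i) ≈ ∑[ p < k ] ∑[ a < k ] (m ×ᵐ f p a)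
    ∑-inflate f = sum-cong-≋ λ p → ∑-quotient k m (f p)

module _ {a b ℓ₁ ℓ₂} (H : AbelianGroup a ℓ₁) (K : AbelianGroup b ℓ₂) where

  private
    module H = AbelianGroup H
    module K = AbelianGroup K
    module H⊕K = AbelianGroup (H ⊕ K)

  ∑-⊕ : ∀ {n} (f : Fin n → H.Carrier × K.Carrier) → ∑ (H ⊕ K) f H⊕K.≈ (∑ H (proj₁ ∘ f) , ∑ K (proj₂ ∘ f))
  ∑-⊕ {zero}  f = H⊕K.refl
  ∑-⊕ {suc n} f = H⊕K.∙-congˡ (∑-⊕ (f ∘ suc))

  isMagic-⊕ : ∀ {n s t μ ν} → IsMagic H n s μ → IsMagic K n t ν →
              IsMagic (H ⊕ K) n (λ i j → s i j , t i j) (μ , ν)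
  isMagic-⊕ {s = s} {t} (row₁ , col₁ , diag₁ , anti₁) (row₂ , col₂ , diag₂ , anti₂) =
      (λ i → ∑-⊕-≈ (λ j → s i j , t i j) (row₁ i) (row₂ i))
    , (λ j → ∑-⊕-≈ (λ i → s i j , t i j) (col₁ j) (col₂ j))
    , ∑-⊕-≈ (λ i → s i i , t i i) diag₁ diag₂
    , ∑-⊕-≈ (λ i → s i (opposite i) , t i (opposite i)) anti₁ anti₂
    where
    ∑-⊕-≈ : ∀ {n} (f : Fin n → H.Carrier × K.Carrier) {μ ν} →
            ∑ H (proj₁ ∘ f) H.≈ μ → ∑ K (proj₂ ∘ f) K.≈ ν → ∑ (H ⊕ K) f H⊕K.≈ (μ , ν)
    ∑-⊕-≈ f e₁ e₂ = H⊕K.trans (∑-⊕ f) (e₁ , e₂)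

  isArrangement-product : ∀ {k} .{{_ : NonZero k}} m {A} {κ : Fin k × Fin k → K.Carrier} →
    IsArrangement H (k * m) A →
    (∀ x y → κ x K.≈ κ y → x ≡ y) → (∀ g → ∃ λ x → κ x K.≈ g) →
    IsArrangement (H ⊕ K) (k * (k * m)) (flatten (product m A κ))
  isArrangement-product m {A} {κ} (A-injective , A-surjective) κ-injective κ-surjective =
    isArrangement-flatten (H ⊕ K) (product m A κ) injective surjective
    where
    injective : ∀ u v u′ v′ → product m A κ u v H⊕K.≈ product m A κ u′ v′ → u ≡ u′ × v ≡ v′
    injective (p , i) (q , j) (p′ , i′) (q′ , j′) (eA , eκ) with A-injective i j i′ j′ eA
    ... | ≡.refl , ≡.refl with shear-injective (quotient m i) (quotient m j) (κ-injective _ _ eκ)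
    ... | ≡.refl , ≡.refl = ≡.refl , ≡.refl

    surjective : ∀ g → ∃₂ λ u v → product m A κ u v H⊕K.≈ g
    surjective (h , y) =
      let (i , j , eA) = A-surjective h
          (xy , eκ) = κ-surjective y
          (p , q , eS) = shear-surjective (quotient m i) (quotient m j) xy
      in (p , i) , (q , j) , eA , K.trans (K.reflexive (cong κ eS)) eκ

mainTheorem5 : ∀ {a b ℓ₁ ℓ₂ : Level} (k m : ℕ) → NonZero k → NonZero m →
    (H : AbelianGroup a ℓ₁) (K : AbelianGroup b ℓ₂) →
    HasOrder H ((k * k) * (m * m)) → HasOrder K (k * k) →
    MagicSquare H (k * m) → MagicSquare (H ⊕ K) ((k * k) * m)
mainTheorem5 k m k≢0 _ H K _ K-order (A , A-arrangement , μ , A-magic) with hasOrder-* K K-order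
... | κ , κ-injective , κ-surjective =
  subst (MagicSquare (H ⊕ K)) (≡.sym (ℕ.*-assoc k k m))
    ( flatten (product {{k≢0}} m A κ)
    , isArrangement-product H K {{k≢0}} m A-arrangement κ-injective κ-surjective
    , _
    , isMagic-⊕ H K (isMagic-tile H k A-magic) (isMagic-latin K {{k≢0}} m κ))
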